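{- Let $n\ge3$ and $1\le k\le n-2$ be integers with $\gcd(n,k(k+1))=1$, and let $\tilde k$ be an integer with $k\tilde k\equiv1\pmod n$. In $\mathrm{PSL}_2(\mathbb{Z})$ let $\Gamma(2)$ be the principal congruence subgroup of level $2$, $\Gamma(2)'$ its commutator subgroup, $A=\begin{bmatrix}1&2\\0&1\end{bmatrix}$, $B=\begin{bmatrix}1&0\\2&1\end{bmatrix}$, and $\Phi_k=\langle AB^{ -\tilde k},A^n,B^n,\Gamma(2)'\rangle$. Then for all integers $r,s$ and all $1\le m\le n-1$, the right cosets $\Phi_kA^rB^s$ and $\Phi_kA^{r+m}B^{s-m\tilde k}$ of $\Phi_k$ in $\Gamma(2)$ coincide. In particular $\Phi_kA^rB^s=\Phi_kA^{r+ks}$. Moreover, $\{\Phi_kA^r: 0\le r\le n-1\}$ is a complete set of representatives of the right cosets of $\Phi_k$ in $\Gamma(2)$. -}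

module Defs where

open import Data.Integer using (ℤ; +_; -[1+_]; _+_; _*_; _-_; -_)
open import Data.Integer.Divisibility using (_∣_)
open import Data.Nat using (ℕ; zero; suc)
open import Data.Product using (Σ; _×_; ∃; ∃-syntax)
open import Relation.Binary.PropositionalEquality using (_≡_)

record M : Set where
  constructor mat
  field
    a b c d : ℤ
open M public

_·_ : M → M → M
mat a₁ b₁ c₁ d₁ · mat a₂ b₂ c₂ d₂ =
  mat (a₁ * a₂ + b₁ * c₂) (a₁ * b₂ + b₁ * d₂)
      (c₁ * a₂ + d₁ * c₂) (c₁ * b₂ + d₁ * d₂)
infixl 7 _·_

det : M → ℤ
det (mat a b c d) = a * d - b * c

-- inverse of a determinant-1 matrix (adjugate)
inv : M → M
inv (mat a b c d) = mat d (- b) (- c) a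

I : M
I = mat (+ 1) (+ 0) (+ 0) (+ 1)

-I : M
-I = mat (- + 1) (+ 0) (+ 0) (- + 1)

powℕ : M → ℕ → M
powℕ x zero = I
powℕ x (suc n) = x · powℕ x n

_^ᶻ_ : M → ℤ → M
x ^ᶻ (+ n) = powℕ x n
x ^ᶻ -[1+ n ] = powℕ (inv x) (suc n)
infixr 8 _^ᶻ_

Amat : M
Amat = mat (+ 1) (+ 2) (+ 0) (+ 1)

Bmat : M
Bmat = mat (+ 1) (+ 0) (+ 2) (+ 1)

-- PSL₂(ℤ) is modelled by SL₂(ℤ) modulo ±I: a subgroup of PSL₂(ℤ) is
-- represented by its preimage in SL₂(ℤ), a subgroup containing -I.
data ⟨_⟩± (S : M → Set) : M → Set where
  gen  : ∀ {x} → S x → ⟨ S ⟩± x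
  unit : ⟨ S ⟩± I
  negI : ⟨ S ⟩± -I
  mul  : ∀ {x y} → ⟨ S ⟩± x → ⟨ S ⟩± y → ⟨ S ⟩± (x · y)
  inv' : ∀ {x} → ⟨ S ⟩± x → ⟨ S ⟩± (inv x)

-- Preimage of Γ(2) in SL₂(ℤ): det 1 and ≡ I (mod 2)  (note -I ≡ I mod 2)
Γ2 : M → Set
Γ2 (mat a b c d) =
  (a * d - b * c ≡ + 1) × (+ 2 ∣ (a - + 1)) × (+ 2 ∣ b) × (+ 2 ∣ c) × (+ 2 ∣ (d - + 1))

Comm2 : M → Set
Comm2 g = ∃[ x ] ∃[ y ] (Γ2 x × Γ2 y × g ≡ x · y · inv x · inv y)

-- generators of Φ_k = ⟨ A B^{-k̃}, Aⁿ, Bⁿ, Γ(2)' ⟩  (Γ(2)' is generated by commutators)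
ΦGen : ℕ → ℤ → M → Set
ΦGen n kt g =
  (g ≡ Amat · Bmat ^ᶻ (- kt)) ⊎′ ((g ≡ powℕ Amat n) ⊎′ ((g ≡ powℕ Bmat n) ⊎′ Comm2 g))
  where
  open import Data.Sum using () renaming (_⊎_ to _⊎′_)

Φ : ℕ → ℤ → M → Set
Φ n kt = ⟨ ΦGen n kt ⟩±

SameCoset : (M → Set) → M → M → Set
SameCoset H x y = H (x · inv y)

{-# OPTIONS --safe #-}
-- Γ(2)/{±I} is free on A and B, so there is a homomorphism Γ(2) → ℤ with A ↦ 1, B ↦ k, −I ↦ 0.
-- It is computed by the Euclidean algorithm on the first column of g, and proved well defined
-- and additive directly from the uniqueness of each Euclidean step. The generators of Φ_k have
-- weights 1 − k k̃, n, k n and 0, so Φ_k lies in the kernel modulo n. Conversely, modulo Φ_k the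
-- matrices A and B commute and B ≡ A^k (as A ≡ B^k̃ and B^n ≡ 1), so replaying the Euclidean
-- steps gives Φ_k g = Φ_k A^(weight g). Thus Φ_k x = Φ_k y iff the weights of x and y agree
-- modulo n, and each claim is a congruence between weights.
module Submission where

open import Defs
open import Data.Nat using (ℕ; _≤_; _<_; _∸_)
open import Data.Nat.GCD using (gcd)
open import Data.Integer using (ℤ; +_; _+_; _*_; _-_)
open import Data.Integer.Divisibility using (_∣_)
open import Data.Product using (_×_; ∃-syntax)
open import Relation.Binary.PropositionalEquality using (_≡_)

open import Data.Nat as ℕ using (zero; suc)
import Data.Nat.Properties as ℕₚ
open import Data.Nat.DivMod using (m<n⇒m%n≡m)
open import Data.Nat.Divisibility using (n∣m⇒m%n≡0)
open import Data.Integer as ℤ using (-[1+_]; -_; ∣_∣; 0ℤ; 1ℤ; _/ℕ_; _%ℕ_)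
open import Data.Integer.DivMod using (a≡a%ℕn+[a/ℕn]*n; n%ℕd<d)
import Data.Integer.Properties as ℤₚ
import Data.Integer.Divisibility.Signed as Signed
open import Data.Integer.Tactic.RingSolver using (solve)
open import Data.List using (_∷_; [])
open import Data.Product using (_,_; proj₁; proj₂)
open import Data.Sum using (_⊎_; inj₁; inj₂)
open import Data.Empty using (⊥-elim)
open import Function using (_$_)
open import Relation.Nullary using (¬_; yes; no)
open import Relation.Binary.PropositionalEquality
open import Relation.Binary.Definitions using (tri<; tri≈; tri>)

mat-cong : ∀ {a b c d a′ b′ c′ d′} → a ≡ a′ → b ≡ b′ → c ≡ c′ → d ≡ d′ →
           mat a b c d ≡ mat a′ b′ c′ d′
mat-cong refl refl refl refl = refl

·-assoc : ∀ x y z → (x · y) · z ≡ x · (y · z)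
·-assoc (mat a b c d) (mat e f g h) (mat i j k l) =
  mat-cong (entry a b) (entry′ a b) (entry c d) (entry′ c d)
  where
  entry : ∀ a b → (a * e + b * g) * i + (a * f + b * h) * k ≡ a * (e * i + f * k) + b * (g * i + h * k)
  entry a b = solve (a ∷ b ∷ e ∷ f ∷ g ∷ h ∷ i ∷ k ∷ [])
  entry′ : ∀ a b → (a * e + b * g) * j + (a * f + b * h) * l ≡ a * (e * j + f * l) + b * (g * j + h * l)
  entry′ a b = solve (a ∷ b ∷ e ∷ f ∷ g ∷ h ∷ j ∷ l ∷ [])

·-identityˡ : ∀ x → I · x ≡ x
·-identityˡ (mat a b c d) = mat-cong (left a c) (left b d) (right a c) (right b d)
  where
  left : ∀ u v → 1ℤ * u + 0ℤ * v ≡ u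
  left u v = solve (u ∷ v ∷ [])
  right : ∀ u v → 0ℤ * u + 1ℤ * v ≡ v
  right u v = solve (u ∷ v ∷ [])

·-identityʳ : ∀ x → x · I ≡ x
·-identityʳ (mat a b c d) = mat-cong (left a b) (right a b) (left c d) (right c d)
  where
  left : ∀ u v → u * 1ℤ + v * 0ℤ ≡ u
  left u v = solve (u ∷ v ∷ [])
  right : ∀ u v → u * 0ℤ + v * 1ℤ ≡ v
  right u v = solve (u ∷ v ∷ [])

det-· : ∀ x y → det (x · y) ≡ det x * det y
det-· (mat a b c d) (mat e f g h) = identity
  where
  identity : (a * e + b * g) * (c * f + d * h) - (a * f + b * h) * (c * e + d * g)
             ≡ (a * d - b * c) * (e * h - f * g)
  identity = solve (a ∷ b ∷ c ∷ d ∷ e ∷ f ∷ g ∷ h ∷ [])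

det-inv : ∀ x → det (inv x) ≡ det x
det-inv (mat a b c d) = identity
  where
  identity : d * a - (- b) * (- c) ≡ a * d - b * c
  identity = solve (a ∷ b ∷ c ∷ d ∷ [])

inv-involutive : ∀ x → inv (inv x) ≡ x
inv-involutive (mat a b c d) = mat-cong refl (ℤₚ.neg-involutive b) (ℤₚ.neg-involutive c) refl

inv-· : ∀ x y → inv (x · y) ≡ inv y · inv x
inv-· (mat a b c d) (mat e f g h) = mat-cong diag off off′ diag′
  where
  diag : c * f + d * h ≡ h * d + (- f) * (- c)
  diag = solve (c ∷ d ∷ f ∷ h ∷ [])
  off : - (a * f + b * h) ≡ h * (- b) + (- f) * a
  off = solve (a ∷ b ∷ f ∷ h ∷ [])
  off′ : - (c * e + d * g) ≡ (- g) * d + e * (- c)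
  off′ = solve (c ∷ d ∷ e ∷ g ∷ [])
  diag′ : a * e + b * g ≡ (- g) * (- b) + e * a
  diag′ = solve (a ∷ b ∷ e ∷ g ∷ [])

·-inverseʳ : ∀ x → det x ≡ 1ℤ → x · inv x ≡ I
·-inverseʳ (mat a b c d) det≡1 =
  mat-cong (trans diag det≡1) off off′ (trans diag′ det≡1)
  where
  diag : a * d + b * (- c) ≡ a * d - b * c
  diag = solve (a ∷ b ∷ c ∷ d ∷ [])
  diag′ : c * (- b) + d * a ≡ a * d - b * c
  diag′ = solve (a ∷ b ∷ c ∷ d ∷ [])
  off : a * (- b) + b * a ≡ 0ℤ
  off = solve (a ∷ b ∷ [])
  off′ : c * d + d * (- c) ≡ 0ℤ
  off′ = solve (c ∷ d ∷ [])

·-inverseˡ : ∀ x → det x ≡ 1ℤ → inv x · x ≡ I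
·-inverseˡ x det≡1 = begin
  inv x · x             ≡⟨ cong (inv x ·_) (inv-involutive x) ⟨
  inv x · inv (inv x)   ≡⟨ ·-inverseʳ (inv x) (trans (det-inv x) det≡1) ⟩
  I                     ∎
  where open ≡-Reasoning

Even Odd : ℤ → Set
Even x = ∃[ t ] x ≡ + 2 * t
Odd x = ∃[ t ] x ≡ 1ℤ + + 2 * t

≡I-mod-2 : M → Set
≡I-mod-2 (mat a b c d) = Odd a × Even b × Even c × Odd d

InΓ2 : M → Set
InΓ2 g = det g ≡ 1ℤ × ≡I-mod-2 g

odd*odd+even*even : ∀ {x y z w} → Odd x → Odd y → Even z → Even w → Odd (x * y + z * w)
odd*odd+even*even (s , refl) (t , refl) (u , refl) (w , refl) = s + t + + 2 * s * t + + 2 * u * w , identity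
  where
  identity : (1ℤ + + 2 * s) * (1ℤ + + 2 * t) + (+ 2 * u) * (+ 2 * w)
             ≡ 1ℤ + + 2 * (s + t + + 2 * s * t + + 2 * u * w)
  identity = solve (s ∷ t ∷ u ∷ w ∷ [])

odd*even+even*odd : ∀ {x y z w} → Odd x → Even y → Even z → Odd w → Even (x * y + z * w)
odd*even+even*odd (s , refl) (t , refl) (u , refl) (w , refl) = t + + 2 * s * t + u + + 2 * u * w , identity
  where
  identity : (1ℤ + + 2 * s) * (+ 2 * t) + (+ 2 * u) * (1ℤ + + 2 * w)
             ≡ + 2 * (t + + 2 * s * t + u + + 2 * u * w)
  identity = solve (s ∷ t ∷ u ∷ w ∷ [])

even*odd+odd*even : ∀ {x y z w} → Even x → Odd y → Odd z → Even w → Even (x * y + z * w)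
even*odd+odd*even {x} {y} {z} {w} ex oy oz ew =
  subst Even (ℤₚ.+-comm (z * w) (x * y)) (odd*even+even*odd oz ew ex oy)

even*even+odd*odd : ∀ {x y z w} → Even x → Even y → Odd z → Odd w → Odd (x * y + z * w)
even*even+odd*odd {x} {y} {z} {w} ex ey oz ow =
  subst Odd (ℤₚ.+-comm (z * w) (x * y)) (odd*odd+even*even oz ow ex ey)

even-neg : ∀ {x} → Even x → Even (- x)
even-neg (s , refl) = - s , ℤₚ.neg-distribʳ-* (+ 2) s

odd-+-2* : ∀ {x} e y → Odd x → Odd (x + + 2 * e * y)
odd-+-2* e y (s , refl) = s + e * y , solve (s ∷ e ∷ y ∷ [])

even-+-2* : ∀ {x} e y → Even x → Even (x + + 2 * e * y)
even-+-2* e y (s , refl) = s + e * y , solve (s ∷ e ∷ y ∷ [])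

InΓ2-· : ∀ {x y} → InΓ2 x → InΓ2 y → InΓ2 (x · y)
InΓ2-· {mat a b c d} {mat e f g h} (det-x , oa , eb , ec , od) (det-y , oe , ef , eg , oh) =
  trans (det-· (mat a b c d) (mat e f g h)) (cong₂ _*_ det-x det-y) ,
  odd*odd+even*even oa oe eb eg , odd*even+even*odd oa ef eb oh ,
  even*odd+odd*even ec oe od eg , even*even+odd*odd ec ef od oh

InΓ2-inv : ∀ {x} → InΓ2 x → InΓ2 (inv x)
InΓ2-inv {x@(mat _ _ _ _)} (det-x , oa , eb , ec , od) = trans (det-inv x) det-x , od , even-neg eb , even-neg ec , oa

InΓ2-I : InΓ2 I
InΓ2-I = refl , (0ℤ , refl) , (0ℤ , refl) , (0ℤ , refl) , (0ℤ , refl)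

2∣x-1⇒odd : ∀ {x} → + 2 ∣ (x - 1ℤ) → Odd x
2∣x-1⇒odd {x} 2∣x-1 with Signed.∣ᵤ⇒∣ 2∣x-1
... | Signed.divides t x-1≡t*2 = t , identity x-1≡t*2
  where
  identity : x - 1ℤ ≡ t * + 2 → x ≡ 1ℤ + + 2 * t
  identity eq = begin
    x                    ≡⟨ solve (x ∷ []) ⟩
    1ℤ + (x - 1ℤ)        ≡⟨ cong (λ u → 1ℤ + u) eq ⟩
    1ℤ + t * + 2         ≡⟨ cong (λ u → 1ℤ + u) (ℤₚ.*-comm t (+ 2)) ⟩
    1ℤ + + 2 * t         ∎
    where open ≡-Reasoning

2∣x⇒even : ∀ {x} → + 2 ∣ x → Even x
2∣x⇒even 2∣x with Signed.∣ᵤ⇒∣ 2∣x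
... | Signed.divides t x≡t*2 = t , trans x≡t*2 (ℤₚ.*-comm t (+ 2))

odd⇒2∣x-1 : ∀ {x} → Odd x → + 2 ∣ (x - 1ℤ)
odd⇒2∣x-1 (t , refl) = Signed.∣⇒∣ᵤ {+ 2} (Signed.divides t identity)
  where
  identity : 1ℤ + + 2 * t - 1ℤ ≡ t * + 2
  identity = solve (t ∷ [])

even⇒2∣x : ∀ {x} → Even x → + 2 ∣ x
even⇒2∣x (t , refl) = Signed.∣⇒∣ᵤ {+ 2} (Signed.divides t (ℤₚ.*-comm (+ 2) t))

Γ2⇒InΓ2 : ∀ {g} → Γ2 g → InΓ2 g
Γ2⇒InΓ2 {mat _ _ _ _} (det≡1 , a , b , c , d) =
  det≡1 , 2∣x-1⇒odd a , 2∣x⇒even b , 2∣x⇒even c , 2∣x-1⇒odd d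

InΓ2⇒Γ2 : ∀ {g} → InΓ2 g → Γ2 g
InΓ2⇒Γ2 {mat _ _ _ _} (det≡1 , a , b , c , d) =
  det≡1 , odd⇒2∣x-1 a , even⇒2∣x b , even⇒2∣x c , odd⇒2∣x-1 d

∣i∣≡∣j∣⇒i≡j⊎i≡-j : ∀ i j → ∣ i ∣ ≡ ∣ j ∣ → i ≡ j ⊎ i ≡ - j
∣i∣≡∣j∣⇒i≡j⊎i≡-j (+ m)     (+ .m)     refl = inj₁ refl
∣i∣≡∣j∣⇒i≡j⊎i≡-j (+ zero)  -[1+ n ]   ()
∣i∣≡∣j∣⇒i≡j⊎i≡-j (+ suc m) -[1+ .m ]  refl = inj₂ refl
∣i∣≡∣j∣⇒i≡j⊎i≡-j -[1+ m ]  (+ zero)   ()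
∣i∣≡∣j∣⇒i≡j⊎i≡-j -[1+ m ]  (+ suc .m) refl = inj₂ refl
∣i∣≡∣j∣⇒i≡j⊎i≡-j -[1+ m ]  -[1+ .m ]  refl = inj₁ refl

odd⇒¬even : ∀ {x} → Odd x → ¬ Even x
odd⇒¬even (s , refl) (t , 1+2s≡2t) with ℕₚ.m*n≡1⇒m≡1 2 ∣ t - s ∣ ∣2[t-s]∣≡1
  where
  1≡2[t-s] : 1ℤ ≡ + 2 * (t - s)
  1≡2[t-s] = begin
    1ℤ                      ≡⟨ solve (s ∷ []) ⟩
    1ℤ + + 2 * s - + 2 * s  ≡⟨ cong (_- + 2 * s) 1+2s≡2t ⟩
    + 2 * t - + 2 * s       ≡⟨ solve (s ∷ t ∷ []) ⟩
    + 2 * (t - s)           ∎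
    where open ≡-Reasoning
  ∣2[t-s]∣≡1 : 2 ℕ.* ∣ t - s ∣ ≡ 1
  ∣2[t-s]∣≡1 = trans (sym (ℤₚ.abs-* (+ 2) (t - s))) (cong ∣_∣ (sym 1≡2[t-s]))
... | ()

∣odd∣≢∣even∣ : ∀ {x y} → Odd x → Even y → ∣ x ∣ ≢ ∣ y ∣
∣odd∣≢∣even∣ {x} {y} ox ey ∣x∣≡∣y∣ with ∣i∣≡∣j∣⇒i≡j⊎i≡-j x y ∣x∣≡∣y∣
... | inj₁ refl = odd⇒¬even ox ey
... | inj₂ refl = odd⇒¬even ox (even-neg ey)

∣odd∣>0 : ∀ {x} → Odd x → 0 < ∣ x ∣
∣odd∣>0 {+ zero} ox = ⊥-elim (odd⇒¬even ox (0ℤ , refl))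
∣odd∣>0 {+ suc n} _ = ℕ.z<s
∣odd∣>0 { -[1+ n ]} _ = ℕ.z<s

small-shift-unique : ∀ a c j j′ → ∣ a + + 2 * j * c ∣ < ∣ c ∣ → ∣ a + + 2 * j′ * c ∣ < ∣ c ∣ →
                     j ≡ j′
small-shift-unique a c j j′ X<c Y<c =
  ℤₚ.i-j≡0⇒i≡j j j′ (ℤₚ.∣i∣≡0⇒i≡0 (ℕₚ.n<1⇒n≡0
    (ℕₚ.*-cancelʳ-< (∣ + 2 * c ∣) (∣ j - j′ ∣) 1 bound)))
  where
  X Y : ℤ
  X = a + + 2 * j * c
  Y = a + + 2 * j′ * c
  difference : (a + + 2 * j * c) - (a + + 2 * j′ * c) ≡ (j - j′) * (+ 2 * c)
  difference = solve (a ∷ c ∷ j ∷ j′ ∷ [])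
  bound : ∣ j - j′ ∣ ℕ.* ∣ + 2 * c ∣ < 1 ℕ.* ∣ + 2 * c ∣
  bound = begin-strict
    ∣ j - j′ ∣ ℕ.* ∣ + 2 * c ∣  ≡⟨ ℤₚ.abs-* (j - j′) (+ 2 * c) ⟨
    ∣ (j - j′) * (+ 2 * c) ∣    ≡⟨ cong ∣_∣ difference ⟨
    ∣ X - Y ∣                   ≤⟨ ℤₚ.∣i-j∣≤∣i∣+∣j∣ X Y ⟩
    ∣ X ∣ ℕ.+ ∣ Y ∣             <⟨ ℕₚ.+-mono-< X<c Y<c ⟩
    ∣ c ∣ ℕ.+ ∣ c ∣             ≡⟨ cong (∣ c ∣ ℕ.+_) (ℕₚ.+-identityʳ ∣ c ∣) ⟨
    2 ℕ.* ∣ c ∣                 ≡⟨ ℤₚ.abs-* (+ 2) c ⟨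
    ∣ + 2 * c ∣                 ≡⟨ ℕₚ.*-identityˡ ∣ + 2 * c ∣ ⟨
    1 ℕ.* ∣ + 2 * c ∣           ∎
    where open ℕₚ.≤-Reasoning

shift-of-smaller-grows : ∀ x y e → ∣ x ∣ < ∣ y ∣ → e ≢ 0ℤ → ∣ y ∣ < ∣ x + + 2 * e * y ∣
shift-of-smaller-grows x y e ∣x∣<∣y∣ e≢0 = ℕₚ.+-cancelʳ-< (∣ y ∣) (∣ y ∣) (∣ U ∣) (begin-strict
  ∣ y ∣ ℕ.+ ∣ y ∣             ≡⟨ cong (∣ y ∣ ℕ.+_) (ℕₚ.+-identityʳ ∣ y ∣) ⟨
  2 ℕ.* ∣ y ∣                 ≡⟨ ℤₚ.abs-* (+ 2) y ⟨
  ∣ + 2 * y ∣                 ≡⟨ ℕₚ.*-identityˡ ∣ + 2 * y ∣ ⟨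
  1 ℕ.* ∣ + 2 * y ∣           ≤⟨ ℕₚ.*-monoˡ-≤ ∣ + 2 * y ∣ 1≤∣e∣ ⟩
  ∣ e ∣ ℕ.* ∣ + 2 * y ∣       ≡⟨ ℤₚ.abs-* e (+ 2 * y) ⟨
  ∣ e * (+ 2 * y) ∣           ≡⟨ cong ∣_∣ difference ⟩
  ∣ U - x ∣                   ≤⟨ ℤₚ.∣i-j∣≤∣i∣+∣j∣ U x ⟩
  ∣ U ∣ ℕ.+ ∣ x ∣             <⟨ ℕₚ.+-monoʳ-< ∣ U ∣ ∣x∣<∣y∣ ⟩
  ∣ U ∣ ℕ.+ ∣ y ∣             ∎)
  where
  open ℕₚ.≤-Reasoning
  U : ℤ
  U = x + + 2 * e * y
  difference : e * (+ 2 * y) ≡ (x + + 2 * e * y) - x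
  difference = solve (x ∷ y ∷ e ∷ [])
  1≤∣e∣ : 1 ≤ ∣ e ∣
  1≤∣e∣ = ℕₚ.n≢0⇒n>0 (λ ∣e∣≡0 → e≢0 (ℤₚ.∣i∣≡0⇒i≡0 ∣e∣≡0))

∣r-N∣≤N : ∀ {r N} .{{_ : ℕ.NonZero N}} → r < N ℕ.+ N → ∣ + r - + N ∣ ≤ N
∣r-N∣≤N {r} {N} r<2N rewrite ℤₚ.m-n≡m⊖n r N with r ℕ.≤? N
... | yes r≤N = subst (_≤ N) (sym (ℤₚ.∣⊖∣-≤ r≤N)) (ℕₚ.m∸n≤m N r)
... | no r≰N =
  subst (_≤ N) (sym (cong ∣_∣ (ℤₚ.⊖-≥ (ℕₚ.≰⇒≥ r≰N)))) (ℕₚ.<⇒≤ (ℕₚ.m<n+o⇒m∸n<o r N r<2N))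

-- Shifting a + N to its remainder modulo 2N moves a into [-N, N).
small-shift-exists⁺ : ∀ a m → ∃[ j ] ∣ a + + 2 * j * + suc m ∣ ≤ suc m
small-shift-exists⁺ a m =
  - q , subst (λ x → ∣ x ∣ ≤ N) (sym (shift a (+ N) (+ r) q (a≡a%ℕn+[a/ℕn]*n (a + + N) (N ℕ.+ N))))
              (∣r-N∣≤N (n%ℕd<d (a + + N) (N ℕ.+ N)))
  where
  N : ℕ
  N = suc m
  q : ℤ
  q = (a + + N) /ℕ (N ℕ.+ N)
  r : ℕ
  r = (a + + N) %ℕ (N ℕ.+ N)
  shift : ∀ a n r q → a + n ≡ r + q * (n + n) → a + + 2 * - q * n ≡ r - n
  shift a n r q eq = begin
    a + + 2 * - q * n                     ≡⟨ solve (a ∷ n ∷ q ∷ []) ⟩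
    (a + n) - n - q * (n + n)             ≡⟨ cong (λ x → x - n - q * (n + n)) eq ⟩
    (r + q * (n + n)) - n - q * (n + n)   ≡⟨ solve (n ∷ r ∷ q ∷ []) ⟩
    r - n                                 ∎
    where open ≡-Reasoning

small-shift-exists : ∀ a c → c ≢ 0ℤ → ∃[ j ] ∣ a + + 2 * j * c ∣ ≤ ∣ c ∣
small-shift-exists a (+ zero) c≢0 = ⊥-elim (c≢0 refl)
small-shift-exists a (+ suc m) _ = small-shift-exists⁺ a m
small-shift-exists a -[1+ m ] _ with small-shift-exists⁺ a m
... | j , small = - j , subst (λ x → ∣ x ∣ ≤ suc m) (flip (+ suc m)) small
  where
  flip : ∀ c → a + + 2 * j * c ≡ a + + 2 * - j * - c
  flip c = solve (a ∷ j ∷ c ∷ [])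

∣-∣-mono-< : ∀ x y → ∣ x ∣ < ∣ y ∣ → ∣ - x ∣ < ∣ - y ∣
∣-∣-mono-< x y = subst₂ _<_ (sym (ℤₚ.∣-i∣≡∣i∣ x)) (sym (ℤₚ.∣-i∣≡∣i∣ y))

A[_] B[_] : ℤ → M
A[ p ] = mat 1ℤ (+ 2 * p) 0ℤ 1ℤ
B[ p ] = mat 1ℤ 0ℤ (+ 2 * p) 1ℤ

rowA rowB : ℤ → M → M
rowA e (mat a b c d) = mat (a + + 2 * e * c) (b + + 2 * e * d) c d
rowB e (mat a b c d) = mat a b (c + + 2 * e * a) (d + + 2 * e * b)

A[]-·≡rowA : ∀ e g → A[ e ] · g ≡ rowA e g
A[]-·≡rowA e (mat a b c d) = mat-cong (top a c) (top b d) (bottom a c) (bottom b d)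
  where
  top : ∀ u v → 1ℤ * u + + 2 * e * v ≡ u + + 2 * e * v
  top u v = solve (u ∷ v ∷ e ∷ [])
  bottom : ∀ u v → 0ℤ * u + 1ℤ * v ≡ v
  bottom u v = solve (u ∷ v ∷ [])

B[]-·≡rowB : ∀ e g → B[ e ] · g ≡ rowB e g
B[]-·≡rowB e (mat a b c d) = mat-cong (top a c) (top b d) (bottom a c) (bottom b d)
  where
  top : ∀ u v → 1ℤ * u + 0ℤ * v ≡ u
  top u v = solve (u ∷ v ∷ [])
  bottom : ∀ u v → + 2 * e * u + 1ℤ * v ≡ v + + 2 * e * u
  bottom u v = solve (u ∷ v ∷ e ∷ [])

A[]-· : ∀ p q → A[ p ] · A[ q ] ≡ A[ p + q ]
A[]-· p q = trans (A[]-·≡rowA p A[ q ]) (mat-cong diag off refl refl)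
  where
  diag : 1ℤ + + 2 * p * 0ℤ ≡ 1ℤ
  diag = solve (p ∷ [])
  off : + 2 * q + + 2 * p * 1ℤ ≡ + 2 * (p + q)
  off = solve (p ∷ q ∷ [])

B[]-· : ∀ p q → B[ p ] · B[ q ] ≡ B[ p + q ]
B[]-· p q = trans (B[]-·≡rowB p B[ q ]) (mat-cong refl refl off diag)
  where
  diag : 1ℤ + + 2 * p * 0ℤ ≡ 1ℤ
  diag = solve (p ∷ [])
  off : + 2 * q + + 2 * p * 1ℤ ≡ + 2 * (p + q)
  off = solve (p ∷ q ∷ [])

A[]-inv : ∀ p → inv A[ p ] ≡ A[ - p ]
A[]-inv p = mat-cong refl (ℤₚ.neg-distribʳ-* (+ 2) p) refl refl

B[]-inv : ∀ p → inv B[ p ] ≡ B[ - p ]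
B[]-inv p = mat-cong refl refl (ℤₚ.neg-distribʳ-* (+ 2) p) refl

InΓ2-A[] : ∀ p → InΓ2 A[ p ]
InΓ2-A[] p = det≡1 , (0ℤ , refl) , (p , refl) , (0ℤ , refl) , (0ℤ , refl)
  where
  det≡1 : 1ℤ * 1ℤ - + 2 * p * 0ℤ ≡ 1ℤ
  det≡1 = solve (p ∷ [])

InΓ2-B[] : ∀ p → InΓ2 B[ p ]
InΓ2-B[] p = det≡1 , (0ℤ , refl) , (0ℤ , refl) , (p , refl) , (0ℤ , refl)
  where
  det≡1 : 1ℤ * 1ℤ - 0ℤ * (+ 2 * p) ≡ 1ℤ
  det≡1 = solve (p ∷ [])

A[_]B[_] : ℤ → ℤ → M
A[ p ]B[ q ] = A[ p ] · B[ q ]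

InΓ2-A[]B[] : ∀ p q → InΓ2 A[ p ]B[ q ]
InΓ2-A[]B[] p q = InΓ2-· (InΓ2-A[] p) (InΓ2-B[] q)

rowA-∘ : ∀ i j g → rowA i (rowA j g) ≡ rowA (j + i) g
rowA-∘ i j (mat a b c d) = mat-cong (shift a c) (shift b d) refl refl
  where
  shift : ∀ u v → u + + 2 * j * v + + 2 * i * v ≡ u + + 2 * (j + i) * v
  shift u v = solve (u ∷ v ∷ i ∷ j ∷ [])

rowB-∘ : ∀ i j g → rowB i (rowB j g) ≡ rowB (j + i) g
rowB-∘ i j (mat a b c d) = mat-cong refl refl (shift c a) (shift d b)
  where
  shift : ∀ u v → u + + 2 * j * v + + 2 * i * v ≡ u + + 2 * (j + i) * v
  shift u v = solve (u ∷ v ∷ i ∷ j ∷ [])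

rowA-0 : ∀ g → rowA 0ℤ g ≡ g
rowA-0 (mat a b c d) = mat-cong (ℤₚ.+-identityʳ a) (ℤₚ.+-identityʳ b) refl refl

rowB-0 : ∀ g → rowB 0ℤ g ≡ g
rowB-0 (mat a b c d) = mat-cong refl refl (ℤₚ.+-identityʳ c) (ℤₚ.+-identityʳ d)

rowA-inverse : ∀ j g → rowA (- j) (rowA j g) ≡ g
rowA-inverse j g = trans (rowA-∘ (- j) j g) (trans (cong (λ i → rowA i g) (ℤₚ.+-inverseʳ j)) (rowA-0 g))

rowB-inverse : ∀ j g → rowB (- j) (rowB j g) ≡ g
rowB-inverse j g = trans (rowB-∘ (- j) j g) (trans (cong (λ i → rowB i g) (ℤₚ.+-inverseʳ j)) (rowB-0 g))

rowA-· : ∀ e x y → rowA e x · y ≡ rowA e (x · y)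
rowA-· e x y = begin
  rowA e x · y       ≡⟨ cong (_· y) (A[]-·≡rowA e x) ⟨
  (A[ e ] · x) · y   ≡⟨ ·-assoc A[ e ] x y ⟩
  A[ e ] · (x · y)   ≡⟨ A[]-·≡rowA e (x · y) ⟩
  rowA e (x · y)     ∎
  where open ≡-Reasoning

rowB-· : ∀ e x y → rowB e x · y ≡ rowB e (x · y)
rowB-· e x y = begin
  rowB e x · y       ≡⟨ cong (_· y) (B[]-·≡rowB e x) ⟨
  (B[ e ] · x) · y   ≡⟨ ·-assoc B[ e ] x y ⟩
  B[ e ] · (x · y)   ≡⟨ B[]-·≡rowB e (x · y) ⟩
  rowB e (x · y)     ∎
  where open ≡-Reasoning

InΓ2-rowA : ∀ e {g} → InΓ2 g → InΓ2 (rowA e g)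
InΓ2-rowA e {g} g∈Γ2 = subst InΓ2 (A[]-·≡rowA e g) (InΓ2-· (InΓ2-A[] e) g∈Γ2)

InΓ2-rowB : ∀ e {g} → InΓ2 g → InΓ2 (rowB e g)
InΓ2-rowB e {g} g∈Γ2 = subst InΓ2 (B[]-·≡rowB e g) (InΓ2-· (InΓ2-B[] e) g∈Γ2)

neg : M → M
neg (mat a b c d) = mat (- a) (- b) (- c) (- d)

neg-· : ∀ x y → neg x · y ≡ neg (x · y)
neg-· (mat a b c d) (mat e f g h) = mat-cong (identity a b e g) (identity a b f h) (identity c d e g) (identity c d f h)
  where
  identity : ∀ a b e g → (- a) * e + (- b) * g ≡ - (a * e + b * g)
  identity a b e g = solve (a ∷ b ∷ e ∷ g ∷ [])

rowA-neg : ∀ e g → rowA e (neg g) ≡ neg (rowA e g)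
rowA-neg e (mat a b c d) = mat-cong (identity a c) (identity b d) refl refl
  where
  identity : ∀ u v → - u + + 2 * e * - v ≡ - (u + + 2 * e * v)
  identity u v = solve (u ∷ v ∷ e ∷ [])

rowB-neg : ∀ e g → rowB e (neg g) ≡ neg (rowB e g)
rowB-neg e (mat a b c d) = mat-cong refl refl (identity c a) (identity d b)
  where
  identity : ∀ u v → - u + + 2 * e * - v ≡ - (u + + 2 * e * v)
  identity u v = solve (u ∷ v ∷ e ∷ [])

unit-cases : ∀ {a d} → a * d ≡ 1ℤ → (a ≡ 1ℤ × d ≡ 1ℤ) ⊎ (a ≡ - 1ℤ × d ≡ - 1ℤ)
unit-cases {a} {d} ad≡1 with ∣i∣≡∣j∣⇒i≡j⊎i≡-j a 1ℤ ∣a∣≡1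
  where
  ∣a∣≡1 : ∣ a ∣ ≡ 1
  ∣a∣≡1 = ℕₚ.m*n≡1⇒m≡1 ∣ a ∣ ∣ d ∣ (trans (sym (ℤₚ.abs-* a d)) (cong ∣_∣ ad≡1))
... | inj₁ refl = inj₁ (refl , trans (sym (ℤₚ.*-identityˡ d)) ad≡1)
... | inj₂ refl = inj₂ (refl , trans (sym (ℤₚ.neg-involutive d)) (cong -_ (trans (sym (ℤₚ.-1*i≡-i d)) ad≡1)))

upper-triangular-Γ2 : ∀ {a b d v} → a * d ≡ 1ℤ → + 2 * v ≡ a * b →
                      mat a b 0ℤ d ≡ A[ v ] ⊎ mat a b 0ℤ d ≡ neg A[ v ]
upper-triangular-Γ2 {a} {b} {d} {v} ad≡1 2v≡ab with unit-cases {a} {d} ad≡1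
... | inj₁ (refl , refl) = inj₁ (mat-cong refl (trans (sym (ℤₚ.*-identityˡ b)) (sym 2v≡ab)) refl refl)
... | inj₂ (refl , refl) = inj₂ (mat-cong refl b≡-2v refl refl)
  where
  b≡-2v : b ≡ - (+ 2 * v)
  b≡-2v = trans (sym (ℤₚ.neg-involutive b)) (cong -_ (trans (sym (ℤₚ.-1*i≡-i b)) (sym 2v≡ab)))

module OneParameterSubgroup (P : ℤ → M) (P-· : ∀ p q → P p · P q ≡ P (p + q))
                            (P-0 : P 0ℤ ≡ I) (P-inv : ∀ p → inv (P p) ≡ P (- p)) where

  powℕ-P : ∀ q m → powℕ (P q) m ≡ P (+ m * q)
  powℕ-P q zero = trans (sym P-0) (cong P (sym (ℤₚ.*-zeroˡ q)))
  powℕ-P q (suc m) = begin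
    P q · powℕ (P q) m   ≡⟨ cong (P q ·_) (powℕ-P q m) ⟩
    P q · P (+ m * q)    ≡⟨ P-· q (+ m * q) ⟩
    P (q + + m * q)      ≡⟨ cong P (ℤₚ.suc-* (+ m) q) ⟨
    P (+ suc m * q)      ∎
    where open ≡-Reasoning

  ^ᶻ-P1 : ∀ p → P 1ℤ ^ᶻ p ≡ P p
  ^ᶻ-P1 (+ m) = trans (powℕ-P 1ℤ m) (cong P (ℤₚ.*-identityʳ (+ m)))
  ^ᶻ-P1 -[1+ m ] = begin
    powℕ (inv (P 1ℤ)) (suc m)   ≡⟨ cong (λ x → powℕ x (suc m)) (P-inv 1ℤ) ⟩
    powℕ (P (- 1ℤ)) (suc m)     ≡⟨ powℕ-P (- 1ℤ) (suc m) ⟩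
    P (+ suc m * - 1ℤ)          ≡⟨ cong P (trans (ℤₚ.*-comm (+ suc m) (- 1ℤ)) (ℤₚ.-1*i≡-i (+ suc m))) ⟩
    P -[1+ m ]                  ∎
    where open ≡-Reasoning

Amat-^ᶻ : ∀ p → Amat ^ᶻ p ≡ A[ p ]
Amat-^ᶻ = OneParameterSubgroup.^ᶻ-P1 A[_] A[]-· refl A[]-inv

Bmat-^ᶻ : ∀ p → Bmat ^ᶻ p ≡ B[ p ]
Bmat-^ᶻ = OneParameterSubgroup.^ᶻ-P1 B[_] B[]-· refl B[]-inv

Amat^Bmat^≡A[]B[] : ∀ r s → Amat ^ᶻ r · Bmat ^ᶻ s ≡ A[ r ]B[ s ]
Amat^Bmat^≡A[]B[] r s = cong₂ _·_ (Amat-^ᶻ r) (Bmat-^ᶻ s)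

Amat·Bmat^-kt≡A[]B[] : ∀ kt → Amat · Bmat ^ᶻ (- kt) ≡ A[ 1ℤ ]B[ - kt ]
Amat·Bmat^-kt≡A[]B[] kt = cong (Amat ·_) (Bmat-^ᶻ (- kt))

module EuclideanWeight (k : ℤ) where

  -- Weight g v: left-multiplying by the unique A[ j ] (if ∣c∣ < ∣a∣) or B[ l ] (if ∣a∣ < ∣c∣)
  -- that makes the larger first-column entry smaller than the other reaches ±A[ u ]; v is the
  -- A-exponent sum plus k times the B-exponent sum of the resulting word for ±g.
  data Weight : M → ℤ → Set where
    ±A[] : ∀ {a b d v} → a * d ≡ 1ℤ → + 2 * v ≡ a * b → Weight (mat a b 0ℤ d) v
    A-step : ∀ {a b c d v} j → ∣ c ∣ < ∣ a ∣ → ∣ a + + 2 * j * c ∣ < ∣ c ∣ →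
             Weight (rowA j (mat a b c d)) v → Weight (mat a b c d) (v - j)
    B-step : ∀ {a b c d v} l → ∣ a ∣ < ∣ c ∣ → ∣ c + + 2 * l * a ∣ < ∣ a ∣ →
             Weight (rowB l (mat a b c d)) v → Weight (mat a b c d) (v - k * l)

  cast : ∀ {g g′ v v′} → g ≡ g′ → v ≡ v′ → Weight g v → Weight g′ v′
  cast refl refl w = w

  weight-unique : ∀ {g v w} → Weight g v → Weight g w → v ≡ w
  weight-unique (±A[] _ 2v≡ab) (±A[] _ 2w≡ab) = ℤₚ.*-cancelˡ-≡ (+ 2) _ _ (trans 2v≡ab (sym 2w≡ab))
  weight-unique (±A[] _ _) (A-step _ _ () _)
  weight-unique (±A[] _ _) (B-step _ () _ _)
  weight-unique (A-step _ _ () _) (±A[] _ _)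
  weight-unique (B-step _ () _ _) (±A[] _ _)
  weight-unique (A-step _ c<a _ _) (B-step _ a<c _ _) = ⊥-elim (ℕₚ.<-asym c<a a<c)
  weight-unique (B-step _ a<c _ _) (A-step _ c<a _ _) = ⊥-elim (ℕₚ.<-asym a<c c<a)
  weight-unique (A-step {a = a} {c = c} j _ small w) (A-step j′ _ small′ w′)
    with small-shift-unique a c j j′ small small′
  ... | refl = cong (_- j) (weight-unique w w′)
  weight-unique (B-step {a = a} {c = c} l _ small w) (B-step l′ _ small′ w′)
    with small-shift-unique c a l l′ small small′
  ... | refl = cong (_- k * l) (weight-unique w w′)

  weight-exists : ∀ {g} → InΓ2 g → ∃[ v ] Weight g v
  weight-exists {g} g∈Γ2 = bounded (suc (∣ M.a g ∣ ℕ.+ ∣ M.c g ∣)) g (ℕₚ.n<1+n _) g∈Γ2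
    where
    bounded : ∀ fuel g → ∣ M.a g ∣ ℕ.+ ∣ M.c g ∣ < fuel → InΓ2 g → ∃[ v ] Weight g v
    bounded zero g () _
    bounded (suc fuel) g@(mat a b c d) size<fuel g∈Γ2@(det≡1 , oa , (t , refl) , ec , _) with c ℤ.≟ 0ℤ
    ... | yes refl = a * t , ±A[] (trans det-triangular det≡1) top-right
      where
      det-triangular : a * d ≡ a * d - + 2 * t * 0ℤ
      det-triangular = solve (a ∷ d ∷ t ∷ [])
      top-right : + 2 * (a * t) ≡ a * (+ 2 * t)
      top-right = solve (a ∷ t ∷ [])
    ... | no c≢0 with ℕₚ.<-cmp ∣ c ∣ ∣ a ∣
    ...   | tri< c<a _ _ =
      let j , ≤c = small-shift-exists a c c≢0
          small = ℕₚ.≤∧≢⇒< ≤c (∣odd∣≢∣even∣ (odd-+-2* j c oa) ec)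
          v , w = bounded fuel (rowA j g)
                    (ℕₚ.<-≤-trans (ℕₚ.+-monoˡ-< ∣ c ∣ (ℕₚ.<-trans small c<a)) (ℕₚ.≤-pred size<fuel))
                    (InΓ2-rowA j g∈Γ2)
      in v - j , A-step j c<a small w
    ...   | tri≈ _ ∣c∣≡∣a∣ _ = ⊥-elim (∣odd∣≢∣even∣ oa ec (sym ∣c∣≡∣a∣))
    ...   | tri> _ _ a<c =
      let l , ≤a = small-shift-exists c a (λ a≡0 → ℕₚ.<-irrefl (cong ∣_∣ (sym a≡0)) (∣odd∣>0 oa))
          small = ℕₚ.≤∧≢⇒< ≤a (≢-sym (∣odd∣≢∣even∣ oa (even-+-2* l a ec)))
          v , w = bounded fuel (rowB l g)
                    (ℕₚ.<-≤-trans (ℕₚ.+-monoʳ-< ∣ a ∣ (ℕₚ.<-trans small a<c)) (ℕₚ.≤-pred size<fuel))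
                    (InΓ2-rowB l g∈Γ2)
      in v - k * l , B-step l a<c small w

  weight-rowA-fresh : ∀ e {g v} → e ≢ 0ℤ → ∣ M.a g ∣ < ∣ M.c g ∣ → Weight g v → Weight (rowA e g) (v + e)
  weight-rowA-fresh e {g@(mat a _ c _)} {v} e≢0 a<c w =
    cast refl (cong (_+_ v) (ℤₚ.neg-involutive e))
      (A-step (- e) (shift-of-smaller-grows a c e a<c e≢0) small (cast (sym (rowA-inverse e g)) refl w))
    where
    small : ∣ M.a (rowA (- e) (rowA e g)) ∣ < ∣ c ∣
    small = subst (λ x → ∣ M.a x ∣ < ∣ c ∣) (sym (rowA-inverse e g)) a<c

  weight-rowB-fresh : ∀ e {g v} → e ≢ 0ℤ → ∣ M.c g ∣ < ∣ M.a g ∣ → Weight g v →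
                      Weight (rowB e g) (v + k * e)
  weight-rowB-fresh e {g@(mat a _ c _)} {v} e≢0 c<a w =
    cast refl weight≡
      (B-step (- e) (shift-of-smaller-grows c a e c<a e≢0) small (cast (sym (rowB-inverse e g)) refl w))
    where
    weight≡ : v - k * - e ≡ v + k * e
    weight≡ = solve (v ∷ k ∷ e ∷ [])
    small : ∣ M.c (rowB (- e) (rowB e g)) ∣ < ∣ a ∣
    small = subst (λ x → ∣ M.c x ∣ < ∣ a ∣) (sym (rowB-inverse e g)) c<a

  weight-rowA : ∀ e {g v} → ≡I-mod-2 g → Weight g v → Weight (rowA e g) (v + e)
  weight-rowA e {g} {v} _ w with e ℤ.≟ 0ℤ
  ... | yes refl = cast (sym (rowA-0 g)) (sym (ℤₚ.+-identityʳ v)) w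
  weight-rowA e {mat a b _ d} {v} _ (±A[] ad≡1 2v≡ab) | no _ = ±A[] (trans det-unchanged ad≡1) top-right
    where
    det-unchanged : (a + + 2 * e * 0ℤ) * d ≡ a * d
    det-unchanged = solve (a ∷ d ∷ e ∷ [])
    top-right : + 2 * (v + e) ≡ (a + + 2 * e * 0ℤ) * (b + + 2 * e * d)
    top-right = begin
      + 2 * (v + e)                           ≡⟨ solve (v ∷ e ∷ []) ⟩
      + 2 * v + + 2 * e * 1ℤ                  ≡⟨ cong₂ (λ x y → x + + 2 * e * y) 2v≡ab (sym ad≡1) ⟩
      a * b + + 2 * e * (a * d)               ≡⟨ solve (a ∷ b ∷ d ∷ e ∷ []) ⟩
      (a + + 2 * e * 0ℤ) * (b + + 2 * e * d)  ∎
      where open ≡-Reasoning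
  weight-rowA e {g@(mat a _ c _)} (oa , _ , ec , _) (A-step {v = v} j c<a small w) | no _
    with ℕₚ.<-cmp ∣ c ∣ ∣ a + + 2 * e * c ∣
  ... | tri< c<a′ _ _ = cast refl weight≡ (A-step (j - e) c<a′ small′ (cast (sym rows) refl w))
    where
    weight≡ : v - (j - e) ≡ v - j + e
    weight≡ = solve (v ∷ j ∷ e ∷ [])
    rows : rowA (j - e) (rowA e g) ≡ rowA j g
    rows = trans (rowA-∘ (j - e) e g) (cong (λ i → rowA i g) total-shift)
      where
      total-shift : e + (j - e) ≡ j
      total-shift = solve (e ∷ j ∷ [])
    small′ : ∣ M.a (rowA (j - e) (rowA e g)) ∣ < ∣ c ∣
    small′ = subst (λ x → ∣ M.a x ∣ < ∣ c ∣) (sym rows) small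
  ... | tri≈ _ ∣c∣≡∣a′∣ _ = ⊥-elim (∣odd∣≢∣even∣ (odd-+-2* e c oa) ec (sym ∣c∣≡∣a′∣))
  ... | tri> _ _ a′<c with small-shift-unique a c j e small a′<c
  ...   | refl = cast refl weight≡ w
    where
    weight≡ : v ≡ v - e + e
    weight≡ = solve (v ∷ e ∷ [])
  weight-rowA e _ w@(B-step _ a<c _ _) | no e≢0 = weight-rowA-fresh e e≢0 a<c w

  weight-rowB : ∀ e {g v} → ≡I-mod-2 g → Weight g v → Weight (rowB e g) (v + k * e)
  weight-rowB e {g} {v} _ w with e ℤ.≟ 0ℤ
  ... | yes refl = cast (sym (rowB-0 g)) weight≡ w
    where
    weight≡ : v ≡ v + k * 0ℤ
    weight≡ = solve (v ∷ k ∷ [])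
  weight-rowB e (oa , _) w@(±A[] _ _) | no e≢0 = weight-rowB-fresh e e≢0 (∣odd∣>0 oa) w
  weight-rowB e _ w@(A-step _ c<a _ _) | no e≢0 = weight-rowB-fresh e e≢0 c<a w
  weight-rowB e {g@(mat a _ c _)} (oa , _ , ec , _) (B-step {v = v} l a<c small w) | no _
    with ℕₚ.<-cmp ∣ a ∣ ∣ c + + 2 * e * a ∣
  ... | tri< a<c′ _ _ = cast refl weight≡ (B-step (l - e) a<c′ small′ (cast (sym rows) refl w))
    where
    weight≡ : v - k * (l - e) ≡ v - k * l + k * e
    weight≡ = solve (v ∷ k ∷ l ∷ e ∷ [])
    rows : rowB (l - e) (rowB e g) ≡ rowB l g
    rows = trans (rowB-∘ (l - e) e g) (cong (λ i → rowB i g) total-shift)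
      where
      total-shift : e + (l - e) ≡ l
      total-shift = solve (e ∷ l ∷ [])
    small′ : ∣ M.c (rowB (l - e) (rowB e g)) ∣ < ∣ a ∣
    small′ = subst (λ x → ∣ M.c x ∣ < ∣ a ∣) (sym rows) small
  ... | tri≈ _ ∣a∣≡∣c′∣ _ = ⊥-elim (∣odd∣≢∣even∣ oa (even-+-2* e a ec) ∣a∣≡∣c′∣)
  ... | tri> _ _ c′<a with small-shift-unique c a l e small c′<a
  ...   | refl = cast refl weight≡ w
    where
    weight≡ : v ≡ v - k * e + k * e
    weight≡ = solve (v ∷ k ∷ e ∷ [])

  weight-neg : ∀ {g v} → Weight g v → Weight (neg g) v
  weight-neg (±A[] {a} {b} {d} ad≡1 2v≡ab) = ±A[] (trans (neg*neg a d) ad≡1) (trans 2v≡ab (sym (neg*neg a b)))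
    where
    neg*neg : ∀ x y → (- x) * (- y) ≡ x * y
    neg*neg x y = solve (x ∷ y ∷ [])
  weight-neg (A-step {a} {b} {c} {d} j c<a small w) =
    A-step j (∣-∣-mono-< c a c<a) small′ (cast (sym (rowA-neg j (mat a b c d))) refl (weight-neg w))
    where
    small′ : ∣ M.a (rowA j (neg (mat a b c d))) ∣ < ∣ - c ∣
    small′ = subst (λ x → ∣ M.a x ∣ < ∣ - c ∣) (sym (rowA-neg j (mat a b c d)))
                   (∣-∣-mono-< (a + + 2 * j * c) c small)
  weight-neg (B-step {a} {b} {c} {d} l a<c small w) =
    B-step l (∣-∣-mono-< a c a<c) small′ (cast (sym (rowB-neg l (mat a b c d))) refl (weight-neg w))
    where
    small′ : ∣ M.c (rowB l (neg (mat a b c d))) ∣ < ∣ - a ∣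
    small′ = subst (λ x → ∣ M.c x ∣ < ∣ - a ∣) (sym (rowB-neg l (mat a b c d)))
                   (∣-∣-mono-< (c + + 2 * l * a) a small)

  weight-· : ∀ {x y v u} → InΓ2 x → InΓ2 y → Weight x v → Weight y u → Weight (x · y) (v + u)
  weight-· {y = y} {v} {u} _ y∈Γ2 (±A[] {a} {b} {d} ad≡1 2v≡ab) wy
    with upper-triangular-Γ2 {a} {b} {d} {v} ad≡1 2v≡ab
  ... | inj₁ x≡A[v] = cast rows (ℤₚ.+-comm u v) (weight-rowA v (proj₂ y∈Γ2) wy)
    where
    rows : rowA v y ≡ mat a b 0ℤ d · y
    rows = sym (trans (cong (_· y) x≡A[v]) (A[]-·≡rowA v y))
  ... | inj₂ x≡-A[v] = cast rows (ℤₚ.+-comm u v) (weight-neg (weight-rowA v (proj₂ y∈Γ2) wy))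
    where
    rows : neg (rowA v y) ≡ mat a b 0ℤ d · y
    rows = sym (trans (cong (_· y) x≡-A[v]) (trans (neg-· A[ v ] y) (cong neg (A[]-·≡rowA v y))))
  weight-· {x} {y} {u = u} x∈Γ2 y∈Γ2 (A-step {v = v} j _ _ wx) wy =
    cast (rowA-inverse j (x · y)) weight≡
      (weight-rowA (- j) (proj₂ (InΓ2-rowA j (InΓ2-· x∈Γ2 y∈Γ2)))
        (cast (rowA-· j x y) refl (weight-· (InΓ2-rowA j x∈Γ2) y∈Γ2 wx wy)))
    where
    weight≡ : v + u + - j ≡ v - j + u
    weight≡ = solve (v ∷ u ∷ j ∷ [])
  weight-· {x} {y} {u = u} x∈Γ2 y∈Γ2 (B-step {v = v} l _ _ wx) wy =
    cast (rowB-inverse l (x · y)) weight≡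
      (weight-rowB (- l) (proj₂ (InΓ2-rowB l (InΓ2-· x∈Γ2 y∈Γ2)))
        (cast (rowB-· l x y) refl (weight-· (InΓ2-rowB l x∈Γ2) y∈Γ2 wx wy)))
    where
    weight≡ : v + u + k * - l ≡ v - k * l + u
    weight≡ = solve (v ∷ u ∷ k ∷ l ∷ [])

  weight-I : Weight I 0ℤ
  weight-I = ±A[] refl refl

  weight-inv : ∀ {x v} → InΓ2 x → Weight x v → Weight (inv x) (- v)
  weight-inv {x} {v} x∈Γ2 wx =
    let w , w-inv = weight-exists (InΓ2-inv x∈Γ2)
        v+w≡0 = weight-unique (cast (·-inverseʳ x (proj₁ x∈Γ2)) refl
                                (weight-· x∈Γ2 (InΓ2-inv x∈Γ2) wx w-inv)) weight-I
    in cast refl (w≡-v v+w≡0) w-inv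
    where
    w≡-v : ∀ {w} → v + w ≡ 0ℤ → w ≡ - v
    w≡-v {w} v+w≡0 = begin
      w               ≡⟨ solve (v ∷ w ∷ []) ⟩
      - v + (v + w)   ≡⟨ cong (_+_ (- v)) v+w≡0 ⟩
      - v + 0ℤ        ≡⟨ ℤₚ.+-identityʳ (- v) ⟩
      - v             ∎
      where open ≡-Reasoning

  weight-A[] : ∀ p → Weight A[ p ] p
  weight-A[] p = cast rows (ℤₚ.+-identityˡ p) (weight-rowA p (proj₂ InΓ2-I) weight-I)
    where
    rows : rowA p I ≡ A[ p ]
    rows = trans (sym (A[]-·≡rowA p I)) (·-identityʳ A[ p ])

  weight-B[] : ∀ q → Weight B[ q ] (k * q)
  weight-B[] q = cast rows (ℤₚ.+-identityˡ (k * q)) (weight-rowB q (proj₂ InΓ2-I) weight-I)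
    where
    rows : rowB q I ≡ B[ q ]
    rows = trans (sym (B[]-·≡rowB q I)) (·-identityʳ B[ q ])

  weight-commutator : ∀ {x y} → InΓ2 x → InΓ2 y → Weight (x · y · inv x · inv y) 0ℤ
  weight-commutator {x} {y} x∈Γ2 y∈Γ2 =
    let v , wx = weight-exists x∈Γ2
        u , wy = weight-exists y∈Γ2
        xy∈Γ2 = InΓ2-· {x} x∈Γ2 y∈Γ2
        w = weight-· (InΓ2-· {x · y} xy∈Γ2 (InΓ2-inv {x} x∈Γ2)) (InΓ2-inv {y} y∈Γ2)
              (weight-· xy∈Γ2 (InΓ2-inv {x} x∈Γ2) (weight-· x∈Γ2 y∈Γ2 wx wy) (weight-inv x∈Γ2 wx))
              (weight-inv y∈Γ2 wy)
    in cast refl (cancels v u) w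
    where
    cancels : ∀ v u → v + u + - v + - u ≡ 0ℤ
    cancels v u = solve (v ∷ u ∷ [])

-- Subgroups ⟨ S ⟩± of Γ(2) containing Γ(2)′; they are normal, and A and B commute modulo them.
module ContainingΓ2′ (S : M → Set) (S⊆Γ2 : ∀ {g} → S g → InΓ2 g) (Comm2⊆S : ∀ {g} → Comm2 g → S g) where

  H : M → Set
  H = ⟨ S ⟩±

  H⊆Γ2 : ∀ {g} → H g → InΓ2 g
  H⊆Γ2 (gen s) = S⊆Γ2 s
  H⊆Γ2 unit = InΓ2-I
  H⊆Γ2 negI = refl , (- 1ℤ , refl) , (0ℤ , refl) , (0ℤ , refl) , (- 1ℤ , refl)
  H⊆Γ2 (mul hx hy) = InΓ2-· (H⊆Γ2 hx) (H⊆Γ2 hy)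
  H⊆Γ2 (inv' hx) = InΓ2-inv (H⊆Γ2 hx)

  infix 4 _~_
  record _~_ (x y : M) : Set where
    constructor coset
    field quotient∈H : SameCoset H x y
  open _~_ public

  ~-refl : ∀ {x} → InΓ2 x → x ~ x
  ~-refl {x} x∈Γ2 = coset $ subst H (sym (·-inverseʳ x (proj₁ x∈Γ2))) unit

  ~-sym : ∀ {x y} → x ~ y → y ~ x
  ~-sym {x} {y} (coset x~y) = coset $ subst H (trans (inv-· x (inv y)) (cong (_· inv x) (inv-involutive y))) (inv' x~y)

  ~-trans : ∀ {x y z} → InΓ2 y → x ~ y → y ~ z → x ~ z
  ~-trans {x} {y} {z} y∈Γ2 (coset x~y) (coset y~z) = coset $ subst H product (mul x~y y~z)
    where
    product : (x · inv y) · (y · inv z) ≡ x · inv z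
    product = begin
      (x · inv y) · (y · inv z)   ≡⟨ ·-assoc x (inv y) (y · inv z) ⟩
      x · (inv y · (y · inv z))   ≡⟨ cong (x ·_) (·-assoc (inv y) y (inv z)) ⟨
      x · ((inv y · y) · inv z)   ≡⟨ cong (λ u → x · (u · inv z)) (·-inverseˡ y (proj₁ y∈Γ2)) ⟩
      x · (I · inv z)             ≡⟨ cong (x ·_) (·-identityˡ (inv z)) ⟩
      x · inv z                   ∎
      where open ≡-Reasoning

  commutator∈H : ∀ {x y} → InΓ2 x → InΓ2 y → H (x · y · inv x · inv y)
  commutator∈H {x} {y} x∈Γ2 y∈Γ2 = gen (Comm2⊆S (x , y , InΓ2⇒Γ2 x∈Γ2 , InΓ2⇒Γ2 y∈Γ2 , refl))

  -- z h z⁻¹ = h · [h⁻¹, z]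
  H-conj : ∀ {z h} → InΓ2 z → H h → H ((z · h) · inv z)
  H-conj {z} {h} z∈Γ2 hh = subst H conjugate (mul hh (commutator∈H (InΓ2-inv h∈Γ2) z∈Γ2))
    where
    h∈Γ2 : InΓ2 h
    h∈Γ2 = H⊆Γ2 hh
    conjugate : h · (inv h · z · inv (inv h) · inv z) ≡ (z · h) · inv z
    conjugate = begin
      h · (((inv h · z) · inv (inv h)) · inv z)   ≡⟨ cong (h ·_) (·-assoc (inv h · z) (inv (inv h)) (inv z)) ⟩
      h · ((inv h · z) · (inv (inv h) · inv z))   ≡⟨ cong (h ·_) (·-assoc (inv h) z (inv (inv h) · inv z)) ⟩
      h · (inv h · (z · (inv (inv h) · inv z)))   ≡⟨ ·-assoc h (inv h) (z · (inv (inv h) · inv z)) ⟨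
      (h · inv h) · (z · (inv (inv h) · inv z))   ≡⟨ cong₂ (λ p q → p · (z · (q · inv z)))
                                                           (·-inverseʳ h (proj₁ h∈Γ2)) (inv-involutive h) ⟩
      I · (z · (h · inv z))                       ≡⟨ ·-identityˡ _ ⟩
      z · (h · inv z)                             ≡⟨ ·-assoc z h (inv z) ⟨
      (z · h) · inv z                             ∎
      where open ≡-Reasoning

  ~-congˡ : ∀ {x y} z → InΓ2 z → x ~ y → (z · x) ~ (z · y)
  ~-congˡ {x} {y} z z∈Γ2 (coset x~y) = coset $ subst H (sym quotient) (H-conj z∈Γ2 x~y)
    where
    quotient : (z · x) · inv (z · y) ≡ (z · (x · inv y)) · inv z
    quotient = begin
      (z · x) · inv (z · y)       ≡⟨ cong ((z · x) ·_) (inv-· z y) ⟩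
      (z · x) · (inv y · inv z)   ≡⟨ ·-assoc (z · x) (inv y) (inv z) ⟨
      ((z · x) · inv y) · inv z   ≡⟨ cong (_· inv z) (·-assoc z x (inv y)) ⟩
      (z · (x · inv y)) · inv z   ∎
      where open ≡-Reasoning

  ~-congʳ : ∀ {x y} z → InΓ2 z → x ~ y → (x · z) ~ (y · z)
  ~-congʳ {x} {y} z z∈Γ2 (coset x~y) = coset $ subst H (sym quotient) x~y
    where
    quotient : (x · z) · inv (y · z) ≡ x · inv y
    quotient = begin
      (x · z) · inv (y · z)       ≡⟨ cong ((x · z) ·_) (inv-· y z) ⟩
      (x · z) · (inv z · inv y)   ≡⟨ ·-assoc x z (inv z · inv y) ⟩
      x · (z · (inv z · inv y))   ≡⟨ cong (x ·_) (·-assoc z (inv z) (inv y)) ⟨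
      x · ((z · inv z) · inv y)   ≡⟨ cong (λ u → x · (u · inv y)) (·-inverseʳ z (proj₁ z∈Γ2)) ⟩
      x · (I · inv y)             ≡⟨ cong (x ·_) (·-identityˡ (inv y)) ⟩
      x · inv y                   ∎
      where open ≡-Reasoning

  ~-comm : ∀ {x y} → InΓ2 x → InΓ2 y → (x · y) ~ (y · x)
  ~-comm {x} {y} x∈Γ2 y∈Γ2 = coset $ subst H (sym quotient) (commutator∈H x∈Γ2 y∈Γ2)
    where
    quotient : (x · y) · inv (y · x) ≡ x · y · inv x · inv y
    quotient = trans (cong ((x · y) ·_) (inv-· y x)) (sym (·-assoc (x · y) (inv x) (inv y)))

  H-·-~ : ∀ {h y} → H h → InΓ2 y → (h · y) ~ y
  H-·-~ {h} {y} hh y∈Γ2 = coset $ subst H (sym quotient) hh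
    where
    quotient : (h · y) · inv y ≡ h
    quotient = trans (·-assoc h y (inv y)) (trans (cong (h ·_) (·-inverseʳ y (proj₁ y∈Γ2))) (·-identityʳ h))

  ~-H : ∀ {x y} → InΓ2 x → H x → x ~ y → H y
  ~-H {x} {y} x∈Γ2 hx x~y =
    subst H (·-identityʳ y) (quotient∈H (~-trans x∈Γ2 (~-sym x~y) (coset {x} {I} (subst H (sym (·-identityʳ x)) hx))))

  A[]B[]-·-~ : ∀ p q p′ q′ → A[ p ]B[ q ] · A[ p′ ]B[ q′ ] ~ A[ p + p′ ]B[ q + q′ ]
  A[]B[]-·-~ p q p′ q′ = subst₂ _~_ (sym regroup) ungroup swap
    where
    swap : A[ p ] · ((B[ q ] · A[ p′ ]) · B[ q′ ]) ~ A[ p ] · ((A[ p′ ] · B[ q ]) · B[ q′ ])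
    swap = ~-congˡ A[ p ] (InΓ2-A[] p) (~-congʳ B[ q′ ] (InΓ2-B[] q′) (~-comm (InΓ2-B[] q) (InΓ2-A[] p′)))
    regroup : A[ p ]B[ q ] · A[ p′ ]B[ q′ ] ≡ A[ p ] · ((B[ q ] · A[ p′ ]) · B[ q′ ])
    regroup = begin
      (A[ p ] · B[ q ]) · (A[ p′ ] · B[ q′ ])   ≡⟨ ·-assoc A[ p ] B[ q ] (A[ p′ ] · B[ q′ ]) ⟩
      A[ p ] · (B[ q ] · (A[ p′ ] · B[ q′ ]))   ≡⟨ cong (A[ p ] ·_) (·-assoc B[ q ] A[ p′ ] B[ q′ ]) ⟨
      A[ p ] · ((B[ q ] · A[ p′ ]) · B[ q′ ])   ∎
      where open ≡-Reasoning
    ungroup : A[ p ] · ((A[ p′ ] · B[ q ]) · B[ q′ ]) ≡ A[ p + p′ ]B[ q + q′ ]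
    ungroup = begin
      A[ p ] · ((A[ p′ ] · B[ q ]) · B[ q′ ])   ≡⟨ cong (A[ p ] ·_) (·-assoc A[ p′ ] B[ q ] B[ q′ ]) ⟩
      A[ p ] · (A[ p′ ] · (B[ q ] · B[ q′ ]))   ≡⟨ ·-assoc A[ p ] A[ p′ ] (B[ q ] · B[ q′ ]) ⟨
      (A[ p ] · A[ p′ ]) · (B[ q ] · B[ q′ ])   ≡⟨ cong₂ _·_ (A[]-· p p′) (B[]-· q q′) ⟩
      A[ p + p′ ] · B[ q + q′ ]                 ∎
      where open ≡-Reasoning

  H-A[]B[]-+ : ∀ {p q p′ q′} → H A[ p ]B[ q ] → H A[ p′ ]B[ q′ ] → H A[ p + p′ ]B[ q + q′ ]
  H-A[]B[]-+ {p} {q} {p′} {q′} h h′ =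
    ~-H (InΓ2-· (InΓ2-A[]B[] p q) (InΓ2-A[]B[] p′ q′)) (mul h h′) (A[]B[]-·-~ p q p′ q′)

  H-A[]B[]-neg : ∀ {p q} → H A[ p ]B[ q ] → H A[ - p ]B[ - q ]
  H-A[]B[]-neg {p} {q} h =
    ~-H (InΓ2-· (InΓ2-B[] (- q)) (InΓ2-A[] (- p))) inverse (~-comm (InΓ2-B[] (- q)) (InΓ2-A[] (- p)))
    where
    inverse : H (B[ - q ] · A[ - p ])
    inverse = subst H (trans (inv-· A[ p ] B[ q ]) (cong₂ _·_ (B[]-inv q) (A[]-inv p))) (inv' h)

  H-A[]B[]-* : ∀ {p q} → H A[ p ]B[ q ] → ∀ m → H A[ m * p ]B[ m * q ]
  H-A[]B[]-* {p} {q} h = scaled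
    where
    multiple : ∀ m → H A[ + m * p ]B[ + m * q ]
    multiple zero = subst₂ (λ x y → H A[ x ]B[ y ]) (sym (ℤₚ.*-zeroˡ p)) (sym (ℤₚ.*-zeroˡ q))
                           (subst H (sym (·-identityˡ I)) unit)
    multiple (suc m) = subst₂ (λ x y → H A[ x ]B[ y ]) (sym (ℤₚ.suc-* (+ m) p)) (sym (ℤₚ.suc-* (+ m) q))
                              (H-A[]B[]-+ {p} {q} h (multiple m))
    scaled : ∀ m → H A[ m * p ]B[ m * q ]
    scaled (+ m) = multiple m
    scaled -[1+ m ] = subst₂ (λ x y → H A[ x ]B[ y ])
                             (ℤₚ.neg-distribˡ-* (+ suc m) p) (ℤₚ.neg-distribˡ-* (+ suc m) q)
                             (H-A[]B[]-neg {+ suc m * p} {+ suc m * q} (multiple (suc m)))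

  A[]B[]-~ : ∀ {p q p′ q′} → H A[ p - p′ ]B[ q - q′ ] → A[ p ]B[ q ] ~ A[ p′ ]B[ q′ ]
  A[]B[]-~ {p} {q} {p′} {q′} h =
    ~-trans (InΓ2-· (InΓ2-A[]B[] (p - p′) (q - q′)) (InΓ2-A[]B[] p′ q′)) split (H-·-~ h (InΓ2-A[]B[] p′ q′))
    where
    cancel : ∀ x y → x - y + y ≡ x
    cancel x y = solve (x ∷ y ∷ [])
    split : A[ p ]B[ q ] ~ A[ p - p′ ]B[ q - q′ ] · A[ p′ ]B[ q′ ]
    split = ~-sym (subst₂ (λ x y → A[ p - p′ ]B[ q - q′ ] · A[ p′ ]B[ q′ ] ~ A[ x ]B[ y ])
                          (cancel p p′) (cancel q q′) (A[]B[]-·-~ (p - p′) (q - q′) p′ q′))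

ΦGen⊆Γ2 : ∀ {n kt g} → ΦGen n kt g → InΓ2 g
ΦGen⊆Γ2 {kt = kt} (inj₁ refl) = subst InΓ2 (sym (Amat·Bmat^-kt≡A[]B[] kt)) (InΓ2-A[]B[] 1ℤ (- kt))
ΦGen⊆Γ2 {n} (inj₂ (inj₁ refl)) = subst InΓ2 (sym (Amat-^ᶻ (+ n))) (InΓ2-A[] (+ n))
ΦGen⊆Γ2 {n} (inj₂ (inj₂ (inj₁ refl))) = subst InΓ2 (sym (Bmat-^ᶻ (+ n))) (InΓ2-B[] (+ n))
ΦGen⊆Γ2 (inj₂ (inj₂ (inj₂ (x , y , x∈Γ2 , y∈Γ2 , refl)))) =
  let x∈Γ2′ = Γ2⇒InΓ2 x∈Γ2 ; y∈Γ2′ = Γ2⇒InΓ2 y∈Γ2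
  in InΓ2-· {x · y · inv x} (InΓ2-· {x · y} (InΓ2-· {x} x∈Γ2′ y∈Γ2′) (InΓ2-inv {x} x∈Γ2′))
            (InΓ2-inv {y} y∈Γ2′)

residue-unique : ∀ {n r r′} → r < n → r′ < n → + n Signed.∣ + r - + r′ → r ≡ r′
residue-unique {suc n} {r} {r′} r<n r′<n n∣r-r′ =
  ℤₚ.+-injective (ℤₚ.i-j≡0⇒i≡j (+ r) (+ r′) (ℤₚ.∣i∣≡0⇒i≡0 ∣r-r′∣≡0))
  where
  ∣r-r′∣<n : ∣ + r - + r′ ∣ < suc n
  ∣r-r′∣<n = subst (_< suc n) (cong ∣_∣ (sym (ℤₚ.m-n≡m⊖n r r′)))
                   (ℕₚ.≤-<-trans (ℤₚ.∣m⊝n∣≤m⊔n r r′) (ℕₚ.⊔-lub r<n r′<n))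
  ∣r-r′∣≡0 : ∣ + r - + r′ ∣ ≡ 0
  ∣r-r′∣≡0 = trans (sym (m<n⇒m%n≡m ∣r-r′∣<n)) (n∣m⇒m%n≡0 _ (suc n) (Signed.∣⇒∣ᵤ n∣r-r′))

module Φ-cosets (n : ℕ) (k kt : ℤ) (n∣k*kt-1 : + n Signed.∣ k * kt - 1ℤ) where

  open ContainingΓ2′ (ΦGen n kt) (ΦGen⊆Γ2 {n} {kt}) (λ c → inj₂ (inj₂ (inj₂ c))) public
  open EuclideanWeight k

  weight-A[]B[] : ∀ p q → Weight A[ p ]B[ q ] (p + k * q)
  weight-A[]B[] p q = weight-· (InΓ2-A[] p) (InΓ2-B[] q) (weight-A[] p) (weight-B[] q)

  n∣0 : + n Signed.∣ 0ℤ
  n∣0 = Signed.divides 0ℤ (sym (ℤₚ.*-zeroˡ (+ n)))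

  n∣-by-weight : ∀ {g u v} → Weight g u → + n Signed.∣ u → Weight g v → + n Signed.∣ v
  n∣-by-weight wu n∣u wv = subst (+ n Signed.∣_) (weight-unique wu wv) n∣u

  n∣weight-of-Φ : ∀ {g v} → Φ n kt g → Weight g v → + n Signed.∣ v
  n∣weight-of-Φ (gen (inj₁ refl)) w =
    n∣-by-weight (cast (sym (Amat·Bmat^-kt≡A[]B[] kt)) refl (weight-A[]B[] 1ℤ (- kt)))
      (subst (+ n Signed.∣_) negated (Signed.∣m⇒∣-m n∣k*kt-1)) w
    where
    negated : - (k * kt - 1ℤ) ≡ 1ℤ + k * - kt
    negated = solve (k ∷ kt ∷ [])
  n∣weight-of-Φ (gen (inj₂ (inj₁ refl))) w =
    n∣-by-weight (cast (sym (Amat-^ᶻ (+ n))) refl (weight-A[] (+ n))) Signed.∣-refl w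
  n∣weight-of-Φ (gen (inj₂ (inj₂ (inj₁ refl)))) w =
    n∣-by-weight (cast (sym (Bmat-^ᶻ (+ n))) refl (weight-B[] (+ n))) (Signed.∣n⇒∣m*n k Signed.∣-refl) w
  n∣weight-of-Φ (gen (inj₂ (inj₂ (inj₂ (x , y , x∈Γ2 , y∈Γ2 , refl))))) w =
    n∣-by-weight (weight-commutator {x} {y} (Γ2⇒InΓ2 x∈Γ2) (Γ2⇒InΓ2 y∈Γ2)) n∣0 w
  n∣weight-of-Φ unit w = n∣-by-weight weight-I n∣0 w
  n∣weight-of-Φ negI w = n∣-by-weight (±A[] refl refl) n∣0 w
  n∣weight-of-Φ (mul φx φy) w =
    let x∈Γ2 = H⊆Γ2 φx ; y∈Γ2 = H⊆Γ2 φy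
        v , wx = weight-exists x∈Γ2 ; u , wy = weight-exists y∈Γ2
    in n∣-by-weight (weight-· x∈Γ2 y∈Γ2 wx wy)
                    (Signed.∣m∣n⇒∣m+n (n∣weight-of-Φ φx wx) (n∣weight-of-Φ φy wy)) w
  n∣weight-of-Φ (inv' φx) w =
    let x∈Γ2 = H⊆Γ2 φx ; v , wx = weight-exists x∈Γ2
    in n∣-by-weight (weight-inv x∈Γ2 wx) (Signed.∣m⇒∣-m (n∣weight-of-Φ φx wx)) w

  A[]B[]∈Φ : ∀ {p q} → + n Signed.∣ p + k * q → Φ n kt A[ p ]B[ q ]
  A[]B[]∈Φ {p} {q} n∣p+kq
    with Signed.∣m∣n⇒∣m-n (Signed.∣n⇒∣m*n kt n∣p+kq) (Signed.∣n⇒∣m*n q n∣k*kt-1)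
  ... | Signed.divides γ kt[p+kq]-q[kkt-1]≡γn =
    subst₂ (λ x y → Φ n kt A[ x ]B[ y ]) A-exponent B-exponent
      (H-A[]B[]-+ {p * 1ℤ} {p * - kt} {γ * 0ℤ} {γ * + n} (H-A[]B[]-* generator p) (H-A[]B[]-* Bⁿ∈Φ γ))
    where
    generator : Φ n kt A[ 1ℤ ]B[ - kt ]
    generator = subst (Φ n kt) (Amat·Bmat^-kt≡A[]B[] kt) (gen (inj₁ refl))
    Bⁿ∈Φ : Φ n kt A[ 0ℤ ]B[ + n ]
    Bⁿ∈Φ = subst (Φ n kt) (trans (Bmat-^ᶻ (+ n)) (sym (·-identityˡ B[ + n ]))) (gen (inj₂ (inj₂ (inj₁ refl))))
    A-exponent : p * 1ℤ + γ * 0ℤ ≡ p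
    A-exponent = solve (p ∷ γ ∷ [])
    B-exponent : p * - kt + γ * + n ≡ q
    B-exponent = begin
      p * - kt + γ * + n                                  ≡⟨ cong (_+_ (p * - kt)) kt[p+kq]-q[kkt-1]≡γn ⟨
      p * - kt + (kt * (p + k * q) - q * (k * kt - 1ℤ))   ≡⟨ solve (p ∷ q ∷ k ∷ kt ∷ []) ⟩
      q                                                   ∎
      where open ≡-Reasoning

  A[]B[]-~-A[] : ∀ {p q r} → + n Signed.∣ (p - r) + k * q → A[ p ]B[ q ] ~ A[ r ]
  A[]B[]-~-A[] {p} {q} {r} n∣ = subst (A[ p ]B[ q ] ~_) (·-identityʳ A[ r ])
    (A[]B[]-~ {p} {q} {r} {0ℤ} (A[]B[]∈Φ {p - r} {q - 0ℤ}
      (subst (λ x → + n Signed.∣ p - r + k * x) (sym (ℤₚ.+-identityʳ q)) n∣)))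

  ~A[weight] : ∀ {g v} → InΓ2 g → Weight g v → g ~ A[ v ]
  ~A[weight] {v = v} _ (±A[] {a} {b} {d} ad≡1 2v≡ab) with upper-triangular-Γ2 {a} {b} {d} {v} ad≡1 2v≡ab
  ... | inj₁ g≡A[v] = subst (_~ A[ v ]) (sym g≡A[v]) (~-refl (InΓ2-A[] v))
  ... | inj₂ g≡-A[v] = coset (subst (Φ n kt) quotient negI)
    where
    quotient : -I ≡ mat a b 0ℤ d · inv A[ v ]
    quotient = begin
      -I                     ≡⟨ cong neg (·-inverseʳ A[ v ] (proj₁ (InΓ2-A[] v))) ⟨
      neg (A[ v ] · inv A[ v ])  ≡⟨ neg-· A[ v ] (inv A[ v ]) ⟨
      neg A[ v ] · inv A[ v ]    ≡⟨ cong (_· inv A[ v ]) g≡-A[v] ⟨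
      mat a b 0ℤ d · inv A[ v ]  ∎
      where open ≡-Reasoning
  ~A[weight] {g} g∈Γ2 (A-step {v = v} j _ _ w) = subst₂ _~_ rows powers
    (~-congˡ A[ - j ] (InΓ2-A[] (- j)) (~A[weight] (InΓ2-rowA j g∈Γ2) w))
    where
    rows : A[ - j ] · rowA j g ≡ g
    rows = trans (A[]-·≡rowA (- j) (rowA j g)) (rowA-inverse j g)
    powers : A[ - j ] · A[ v ] ≡ A[ v - j ]
    powers = trans (A[]-· (- j) v) (cong A[_] (ℤₚ.+-comm (- j) v))
  ~A[weight] {g} g∈Γ2 (B-step {v = v} l _ _ w) =
    ~-trans (InΓ2-· (InΓ2-B[] (- l)) (InΓ2-A[] v))
      (subst (_~ B[ - l ] · A[ v ]) rows (~-congˡ B[ - l ] (InΓ2-B[] (- l)) (~A[weight] (InΓ2-rowB l g∈Γ2) w)))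
      (~-trans (InΓ2-A[]B[] v (- l)) (~-comm (InΓ2-B[] (- l)) (InΓ2-A[] v)) (A[]B[]-~-A[] {v} { - l} {v - k * l} n∣0′))
    where
    rows : B[ - l ] · rowB l g ≡ g
    rows = trans (B[]-·≡rowB (- l) (rowB l g)) (rowB-inverse l g)
    n∣0′ : + n Signed.∣ (v - (v - k * l)) + k * - l
    n∣0′ = subst (+ n Signed.∣_) (solve (v ∷ k ∷ l ∷ [])) n∣0

  ~-if-n∣weight-difference : ∀ {x y v w} → InΓ2 x → InΓ2 y → Weight x v → Weight y w →
                             + n Signed.∣ v - w → x ~ y
  ~-if-n∣weight-difference {v = v} {w} x∈Γ2 y∈Γ2 wx wy n∣v-w =
    ~-trans (InΓ2-A[] v) (~A[weight] x∈Γ2 wx)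
      (~-trans (InΓ2-A[] w) A[v]~A[w] (~-sym (~A[weight] y∈Γ2 wy)))
    where
    no-B-part : v - w ≡ v - w + k * 0ℤ
    no-B-part = solve (v ∷ w ∷ k ∷ [])
    A[v]~A[w] : A[ v ] ~ A[ w ]
    A[v]~A[w] = subst (_~ A[ w ]) (·-identityʳ A[ v ])
                  (A[]B[]-~-A[] {v} {0ℤ} {w} (subst (+ n Signed.∣_) no-B-part n∣v-w))

  n∣weight-difference-if-~ : ∀ {x y v w} → InΓ2 x → InΓ2 y → Weight x v → Weight y w →
                             x ~ y → + n Signed.∣ v - w
  n∣weight-difference-if-~ x∈Γ2 y∈Γ2 wx wy x~y =
    n∣weight-of-Φ (quotient∈H x~y) (weight-· x∈Γ2 (InΓ2-inv y∈Γ2) wx (weight-inv y∈Γ2 wy))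

  Amat^Bmat^-coset : ∀ r s r′ s′ → + n Signed.∣ (r + k * s) - (r′ + k * s′) →
                     SameCoset (Φ n kt) (Amat ^ᶻ r · Bmat ^ᶻ s) (Amat ^ᶻ r′ · Bmat ^ᶻ s′)
  Amat^Bmat^-coset r s r′ s′ n∣ =
    subst₂ (SameCoset (Φ n kt)) (sym (Amat^Bmat^≡A[]B[] r s)) (sym (Amat^Bmat^≡A[]B[] r′ s′)) $ quotient∈H $
      ~-if-n∣weight-difference (InΓ2-A[]B[] r s) (InΓ2-A[]B[] r′ s′) (weight-A[]B[] r s) (weight-A[]B[] r′ s′) n∣

  coset-shift : ∀ r s m → SameCoset (Φ n kt) (Amat ^ᶻ r · Bmat ^ᶻ s) (Amat ^ᶻ (r + m) · Bmat ^ᶻ (s - m * kt))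
  coset-shift r s m =
    Amat^Bmat^-coset r s (r + m) (s - m * kt) (subst (+ n Signed.∣_) difference (Signed.∣n⇒∣m*n m n∣k*kt-1))
    where
    difference : m * (k * kt - 1ℤ) ≡ (r + k * s) - (r + m + k * (s - m * kt))
    difference = solve (m ∷ k ∷ r ∷ s ∷ kt ∷ [])

  coset-collapse : ∀ r s → SameCoset (Φ n kt) (Amat ^ᶻ r · Bmat ^ᶻ s) (Amat ^ᶻ (r + k * s))
  coset-collapse r s = subst (SameCoset (Φ n kt) (Amat ^ᶻ r · Bmat ^ᶻ s)) (·-identityʳ (Amat ^ᶻ (r + k * s)))
    (Amat^Bmat^-coset r s (r + k * s) 0ℤ (subst (+ n Signed.∣_) difference n∣0))
    where
    difference : 0ℤ ≡ (r + k * s) - ((r + k * s) + k * 0ℤ)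
    difference = solve (k ∷ r ∷ s ∷ [])

  coset-representative : .{{_ : ℕ.NonZero n}} → ∀ g → Γ2 g →
                         ∃[ r ] (r < n × SameCoset (Φ n kt) g (powℕ Amat r))
  coset-representative g g∈Γ2 with weight-exists (Γ2⇒InΓ2 {g} g∈Γ2)
  ... | v , wg = v %ℕ n , n%ℕd<d v n ,
    subst (SameCoset (Φ n kt) g) (sym (Amat-^ᶻ (+ (v %ℕ n))))
      (quotient∈H (~-if-n∣weight-difference (Γ2⇒InΓ2 {g} g∈Γ2) (InΓ2-A[] (+ (v %ℕ n))) wg (weight-A[] (+ (v %ℕ n)))
        (Signed.divides (v /ℕ n) (minus-remainder (a≡a%ℕn+[a/ℕn]*n v n)))))
    where
    minus-remainder : ∀ {v r q} → v ≡ r + q → v - r ≡ q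
    minus-remainder {r = r} {q} refl = solve (r ∷ q ∷ [])

  coset-representatives-distinct : ∀ {r r′} → r < n → r′ < n →
                                   SameCoset (Φ n kt) (powℕ Amat r) (powℕ Amat r′) → r ≡ r′
  coset-representatives-distinct {r} {r′} r<n r′<n same = residue-unique r<n r′<n
    (n∣weight-difference-if-~ (InΓ2-A[] (+ r)) (InΓ2-A[] (+ r′)) (weight-A[] (+ r)) (weight-A[] (+ r′))
      (coset (subst₂ (SameCoset (Φ n kt)) (Amat-^ᶻ (+ r)) (Amat-^ᶻ (+ r′)) same)))

lemma4p2 : (n k : ℕ) (kt : ℤ) → 3 ≤ n → 1 ≤ k → k ≤ n ∸ 2 →
    gcd n (k Data.Nat.* (k Data.Nat.+ 1)) ≡ 1 →
    (+ n) ∣ ((+ k) * kt - + 1) →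
    ((r s : ℤ) (m : ℕ) → 1 ≤ m → m ≤ n ∸ 1 →
      SameCoset (Φ n kt) (Amat ^ᶻ r · Bmat ^ᶻ s)
        (Amat ^ᶻ (r + + m) · Bmat ^ᶻ (s - + m * kt)))
    × ((r s : ℤ) → SameCoset (Φ n kt) (Amat ^ᶻ r · Bmat ^ᶻ s) (Amat ^ᶻ (r + + k * s)))
    × ((g : M) → Γ2 g → ∃[ r ] (r < n × SameCoset (Φ n kt) g (powℕ Amat r)))
    × ((r r′ : ℕ) → r < n → r′ < n → SameCoset (Φ n kt) (powℕ Amat r) (powℕ Amat r′) → r ≡ r′)
lemma4p2 zero _ _ () _ _ _ _
lemma4p2 n@(suc _) k kt _ _ _ _ n∣k*kt-1 =
  (λ r s m _ _ → coset-shift r s (+ m)) , coset-collapse , coset-representative ,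
  λ _ _ → coset-representatives-distinct
  where
  open Φ-cosets n (+ k) kt (Signed.∣ᵤ⇒∣ n∣k*kt-1)
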